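{- Every strictly $2$-dense number is $\varphi$-practical.
   Context: $\varphi$ denotes Euler's totient function. A positive integer $n$ is $\varphi$-practical if every integer $m$ with $1\le m\le n$ can be written as $m=\sum_{d\in\mathcal D}\varphi(d)$ for some subset $\mathcal D$ of the positive divisors of $n$. For a positive integer $n$ let $1=d_1<d_2<\cdots<d_{\tau(n)}=n$ be its positive divisors in increasing order, where $\tau(n)$ is the number of divisors. A squarefree integer $n$ is strictly $2$-dense if $d_{i+1}/d_i<2$ for all $i$ with $1<i<\tau(n)-1$, and $d_2/d_1=2=d_{\tau(n)}/d_{\tau(n)-1}$ (in particular $n$ is even). -}

module Defs where

open import Data.Nat using (ℕ; zero; suc; _*_; _<_; _≤_)
open import Data.Nat.Divisibility using (_∣_; _∣?_)
open import Data.Nat.GCD using (gcd)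
open import Data.Nat.Properties using (_≟_)
open import Data.List using (List; filter; map; length; lookup)
open import Data.Nat.ListAction using (sum)
open import Data.List.Relation.Binary.Sublist.Propositional using (_⊆_)
open import Data.Fin using (Fin; toℕ)
open import Data.Product using (Σ; _×_)
open import Relation.Binary.PropositionalEquality using (_≡_)

range1 : ℕ → List ℕ
range1 zero    = Data.List.[]
range1 (suc n) = range1 n Data.List.++ (suc n Data.List.∷ Data.List.[])

-- Euler's totient: number of k with 1 ≤ k ≤ n and gcd k n = 1 (φ 0 = 0)
φ : ℕ → ℕ
φ n = length (filter (λ k → gcd k n ≟ 1) (range1 n))

divisors : ℕ → List ℕ
divisors n = filter (λ d → d ∣? n) (range1 n)

τ : ℕ → ℕ
τ n = length (divisors n)

-- d_i, 0-indexed: d i = d_{i+1} in the paper's notation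
d : (n : ℕ) → Fin (τ n) → ℕ
d n i = lookup (divisors n) i

-- φ-practical: every 1 ≤ m ≤ n is a sum of φ(d) over a set of divisors of n
-- (a set of divisors = a sublist of the duplicate-free list of divisors)
φ-practical : ℕ → Set
φ-practical n = ∀ m → 1 ≤ m → m ≤ n →
  Σ (List ℕ) λ D → (D ⊆ divisors n) × (sum (map φ D) ≡ m)

Squarefree : ℕ → Set
Squarefree n = ∀ k → k * k ∣ n → k ≡ 1

-- With 0-indexed divisors e₀ < … < e_{τ-1}:
--   there are at least two divisors, e₁ = 2·e₀, e_{τ-1} = 2·e_{τ-2},
--   and e_{j+1} < 2·e_j for all j with 1 ≤ j and j+1 ≤ τ-2
--   (paper: d_{i+1}/d_i < 2 for 1 < i < τ(n) - 1, i = j + 1).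
Strictly2Dense : ℕ → Set
Strictly2Dense n =
  Squarefree n ×
  Σ ℕ λ t → (τ n ≡ suc (suc t)) ×
  ((∀ (i j : Fin (τ n)) → toℕ j ≡ suc (toℕ i) →
       (toℕ i ≡ 0 → d n j ≡ 2 * d n i) ×
       (toℕ j ≡ suc t → d n j ≡ 2 * d n i) ×
       (1 ≤ toℕ i → toℕ j < suc t → d n j < 2 * d n i)))

module Submission where

-- Call N φ-complete if every a ≤ N (0 included) is a sum of φ(k) over a set of divisors k
-- of N; for N ≥ 1 this is φ-practicality.  The engine is the prime extension lemma: if m
-- is φ-complete and p is a prime with p ∤ m and p ≤ m + 2, then p·m is φ-complete, since
-- the divisors of p·m are the k ∣ m and the p·j with j ∣ m, φ(p·j) = (p − 1)·φ(j), and
-- every c ≤ p·m is a + (p − 1)·b with a, b ≤ m.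
-- A strictly 2-dense n is positive, squarefree and even, and each divisor D with
-- 2 < D < n has a divisor of n strictly between D/2 and D (the record DivisorDense).
-- Write n = P·Q, starting from P = 1, and move the least prime p of Q into P: density
-- forces p ≤ P + 2 and squarefreeness gives p ∤ P, so P stays φ-complete until Q = 1.

open import Defs
open import Algebra.Properties.CommutativeSemigroup using (interchange)
open import Data.Bool.Base using (Bool; true; false; if_then_else_; T)
open import Data.Empty using (⊥)
open import Data.Product.Base using (Σ; _×_; _,_; proj₁; proj₂)
open import Data.Sum.Base using (_⊎_; inj₁; inj₂; [_,_]′)
open import Function.Base using (case_of_)
open import Relation.Nullary using (Dec; yes; no; does; ¬_; contradiction)
open import Relation.Nullary.Decidable using (dec-true; dec-false; T?)
open import Relation.Unary using (Decidable)
open import Relation.Binary.PropositionalEquality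
open import Data.Nat.Base
open import Data.Nat.Properties
open import Data.Nat.Induction using (<-rec)
open import Data.Nat.Divisibility
open import Data.Nat.DivMod using (m*n/n≡m; m≡m%n+[m/n]*n; m/n*n≤m; m%n<n)
open import Data.Nat.GCD using (gcd; gcd[m,n]∣m; gcd[m,n]∣n)
open import Data.Nat.Coprimality using (Coprime; gcd≡1⇒coprime; coprime⇒gcd≡1; coprime-divisor)
open import Data.Nat.Primality using (Prime; _Rough_; prime⇒irreducible; prime⇒nonTrivial; ¬prime[0]; ¬prime[1]; 2-rough; ∤⇒rough-suc; rough∧∣⇒prime)
open import Data.Fin.Base using (Fin; zero; suc; toℕ; fromℕ<)
open import Data.Fin.Properties using (toℕ-injective; toℕ<n; toℕ-fromℕ<)
open import Data.List.Base using ([]; _∷_; _++_; filter; map; length; lookup)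
open import Data.List.Properties using (map-++)
open import Data.Nat.ListAction using (sum)
open import Data.Nat.ListAction.Properties using (sum-++)
open import Data.List.Membership.Propositional using (_∈_)
open import Data.List.Membership.Propositional.Properties using (∈-++⁻; ∈-++⁺ˡ; ∈-++⁺ʳ; ∈-filter⁺; ∈-filter⁻; ∈-lookup)
open import Data.List.Relation.Unary.Any using (here; index)
open import Data.List.Relation.Unary.Any.Properties using (lookup-index)
open import Data.List.Relation.Unary.All as All using ([]; _∷_)
open import Data.List.Relation.Unary.AllPairs using (AllPairs; []; _∷_)
import Data.List.Relation.Unary.AllPairs.Properties as AllPairs
open import Data.List.Relation.Binary.Sublist.Propositional.Properties using (filter-⊆)

open ≡-Reasoning

+-interchange : ∀ a b c d → (a + b) + (c + d) ≡ (a + c) + (b + d)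
+-interchange = interchange +-commutativeSemigroup

-- Finite sums ∑_{k=1}^{N} f k.  The recursion adds the last term, matching range1.
sumTo : (ℕ → ℕ) → ℕ → ℕ
sumTo f zero    = 0
sumTo f (suc N) = sumTo f N + f (suc N)

sumTo-range1 : ∀ f N → sum (map f (range1 N)) ≡ sumTo f N
sumTo-range1 f zero    = refl
sumTo-range1 f (suc N) = begin
  sum (map f (range1 N ++ suc N ∷ []))        ≡⟨ cong sum (map-++ f (range1 N) (suc N ∷ [])) ⟩
  sum (map f (range1 N) ++ f (suc N) ∷ [])    ≡⟨ sum-++ (map f (range1 N)) (f (suc N) ∷ []) ⟩
  sum (map f (range1 N)) + (f (suc N) + 0)
    ≡⟨ cong₂ _+_ (sumTo-range1 f N) (+-identityʳ (f (suc N))) ⟩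
  sumTo f N + f (suc N)                       ∎

sumTo-cong : ∀ {f g} N → (∀ k → 1 ≤ k → k ≤ N → f k ≡ g k) → sumTo f N ≡ sumTo g N
sumTo-cong zero    f≗g = refl
sumTo-cong (suc N) f≗g =
  cong₂ _+_ (sumTo-cong N (λ k 1≤k k≤N → f≗g k 1≤k (m≤n⇒m≤1+n k≤N))) (f≗g (suc N) (s≤s z≤n) ≤-refl)

sumTo-zero : ∀ f N → (∀ k → 1 ≤ k → k ≤ N → f k ≡ 0) → sumTo f N ≡ 0
sumTo-zero f zero    f≗0 = refl
sumTo-zero f (suc N) f≗0 =
  cong₂ _+_ (sumTo-zero f N (λ k 1≤k k≤N → f≗0 k 1≤k (m≤n⇒m≤1+n k≤N)))
            (f≗0 (suc N) (s≤s z≤n) ≤-refl)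

sumTo-+ : ∀ f g N → sumTo (λ k → f k + g k) N ≡ sumTo f N + sumTo g N
sumTo-+ f g zero    = refl
sumTo-+ f g (suc N) rewrite sumTo-+ f g N =
  +-interchange (sumTo f N) (sumTo g N) (f (suc N)) (g (suc N))

sumTo-* : ∀ c f N → sumTo (λ k → c * f k) N ≡ c * sumTo f N
sumTo-* c f zero    = sym (*-zeroʳ c)
sumTo-* c f (suc N) rewrite sumTo-* c f N = sym (*-distribˡ-+ c (sumTo f N) (f (suc N)))

sumTo-split : ∀ f N a → sumTo f (N + a) ≡ sumTo f N + sumTo (λ r → f (N + r)) a
sumTo-split f N zero    rewrite +-identityʳ N = sym (+-identityʳ _)
sumTo-split f N (suc a) rewrite +-suc N a | sumTo-split f N a = +-assoc (sumTo f N) _ _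

-- `gate b v` is v when b holds and 0 otherwise; it turns filters into sums.
gate : Bool → ℕ → ℕ
gate b v = if b then v else 0

gate-yes : ∀ {P : Set} (P? : Dec P) v → P → gate (does P?) v ≡ v
gate-yes P? v p = cong (λ b → gate b v) (dec-true P? p)

gate-no : ∀ {P : Set} (P? : Dec P) v → ¬ P → gate (does P?) v ≡ 0
gate-no P? v ¬p = cong (λ b → gate b v) (dec-false P? ¬p)

gate-cong : ∀ {P : Set} (P? : Dec P) {v w} → (P → v ≡ w) → gate (does P?) v ≡ gate (does P?) w
gate-cong (yes p) v≡w = v≡w p
gate-cong (no _)  v≡w = refl

gate-⇔ : ∀ {P Q : Set} (P? : Dec P) (Q? : Dec Q) v → (P → Q) → (Q → P) →
         gate (does P?) v ≡ gate (does Q?) v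
gate-⇔ (yes _) (yes _) v _   _   = refl
gate-⇔ (yes p) (no ¬q) v P⇒Q _   = contradiction (P⇒Q p) ¬q
gate-⇔ (no ¬p) (yes q) v _   Q⇒P = contradiction (Q⇒P q) ¬p
gate-⇔ (no _)  (no _)  v _   _   = refl

gate-* : ∀ b c v → gate b (c * v) ≡ c * gate b v
gate-* true  c v = refl
gate-* false c v = sym (*-zeroʳ c)

sum-filter : ∀ {P : ℕ → Set} (P? : Decidable P) h xs →
             sum (map h (filter P? xs)) ≡ sum (map (λ k → gate (does (P? k)) (h k)) xs)
sum-filter P? h []       = refl
sum-filter P? h (x ∷ xs) with P? x
... | yes _ = cong (h x +_) (sum-filter P? h xs)
... | no _  = sum-filter P? h xs

length-filter : ∀ {P : ℕ → Set} (P? : Decidable P) xs →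
                length (filter P? xs) ≡ sum (map (λ k → gate (does (P? k)) 1) xs)
length-filter P? []       = refl
length-filter P? (x ∷ xs) with P? x
... | yes _ = cong suc (length-filter P? xs)
... | no _  = length-filter P? xs

sumTo-multiples : ∀ q F N →
  sumTo (λ k → gate (does (suc q ∣? k)) (F k)) (suc q * N) ≡ sumTo (λ j → F (suc q * j)) N
sumTo-multiples q F zero    rewrite *-zeroʳ q = refl
sumTo-multiples q F (suc N) = begin
  sumTo G (p * suc N)
    ≡⟨ cong (sumTo G) p[N+1]≡pN+p ⟩
  sumTo G (p * N + p)
    ≡⟨ sumTo-split G (p * N) p ⟩
  sumTo G (p * N) + (sumTo (λ r → G (p * N + r)) q + G (p * N + p))
    ≡⟨ cong₂ _+_ (sumTo-multiples q F N) (cong₂ _+_ between-multiples last-multiple) ⟩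
  sumTo (λ j → F (p * j)) N + (0 + F (p * suc N))
    ∎
  where
  p : ℕ
  p = suc q
  G : ℕ → ℕ
  G k = gate (does (p ∣? k)) (F k)
  p[N+1]≡pN+p : p * suc N ≡ p * N + p
  p[N+1]≡pN+p = trans (*-suc p N) (+-comm p _)
  -- p·N + r with 0 < r < p is not a multiple of p
  between-multiples : sumTo (λ r → G (p * N + r)) q ≡ 0
  between-multiples = sumTo-zero _ q λ r 1≤r r≤q → gate-no (p ∣? (p * N + r)) _ λ p∣pN+r →
    <⇒≱ (s≤s r≤q) (∣⇒≤ ⦃ >-nonZero 1≤r ⦄ (∣m+n∣m⇒∣n p∣pN+r (m∣m*n N)))
  last-multiple : G (p * N + p) ≡ F (p * suc N)
  last-multiple = trans (gate-yes (p ∣? (p * N + p)) _ (∣m∣n⇒∣m+n (m∣m*n N) ∣-refl))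
                        (cong F (sym p[N+1]≡pN+p))

coprimeTo : ℕ → ℕ → ℕ
coprimeTo x k = gate (does (gcd k x ≟ 1)) 1

φ-as-sum : ∀ N → φ N ≡ sumTo (coprimeTo N) N
φ-as-sum N = trans (length-filter (λ k → gcd k N ≟ 1) (range1 N)) (sumTo-range1 (coprimeTo N) N)

coprimeTo-⇔ : ∀ {x y k l} → (Coprime k x → Coprime l y) → (Coprime l y → Coprime k x) →
              coprimeTo x k ≡ coprimeTo y l
coprimeTo-⇔ {x} {y} {k} {l} ⇒ ⇐ = gate-⇔ (gcd k x ≟ 1) (gcd l y ≟ 1) 1
  (λ g → coprime⇒gcd≡1 (⇒ (gcd≡1⇒coprime g))) (λ g → coprime⇒gcd≡1 (⇐ (gcd≡1⇒coprime g)))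

-- Coprimality to x is x-periodic, so over i full periods there are i·φ(x) coprime residues.
coprime-count-periodic : ∀ x i → sumTo (coprimeTo x) (x * i) ≡ i * φ x
coprime-count-periodic x zero    rewrite *-zeroʳ x = refl
coprime-count-periodic x (suc i) = begin
  sumTo (coprimeTo x) (x * suc i)
    ≡⟨ cong (sumTo (coprimeTo x)) (trans (*-suc x i) (+-comm x _)) ⟩
  sumTo (coprimeTo x) (x * i + x)
    ≡⟨ sumTo-split (coprimeTo x) (x * i) x ⟩
  sumTo (coprimeTo x) (x * i) + sumTo (λ k → coprimeTo x (x * i + k)) x
    ≡⟨ cong₂ _+_ (coprime-count-periodic x i)
                 (sumTo-cong x λ k _ _ → coprimeTo-⇔ {k = x * i + k} {l = k} shift⇒ shift⇐) ⟩
  i * φ x + sumTo (coprimeTo x) x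
    ≡⟨ cong (i * φ x +_) (sym (φ-as-sum x)) ⟩
  i * φ x + φ x
    ≡⟨ +-comm (i * φ x) (φ x) ⟩
  suc i * φ x
    ∎
  where
  shift⇒ : ∀ {k} → Coprime (x * i + k) x → Coprime k x
  shift⇒ c (d∣k , d∣x) = c (∣m∣n⇒∣m+n (∣m⇒∣m*n i d∣x) d∣k , d∣x)
  shift⇐ : ∀ {k} → Coprime k x → Coprime (x * i + k) x
  shift⇐ c (d∣xi+k , d∣x) = c (∣m+n∣m⇒∣n d∣xi+k (∣m⇒∣m*n i d∣x) , d∣x)

prime≢1 : ∀ {p} → Prime p → p ≢ 1
prime≢1 pr refl = ¬prime[1] pr

prime-divisor-split : ∀ {p d x} → Prime p → d ∣ p * x → p ∣ d ⊎ d ∣ x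
prime-divisor-split {p} {d} pr d∣px with prime⇒irreducible pr (gcd[m,n]∣n d p)
... | inj₁ gcd≡1 = inj₂ (coprime-divisor (gcd≡1⇒coprime gcd≡1) d∣px)
... | inj₂ gcd≡p = inj₁ (subst (_∣ d) gcd≡p (gcd[m,n]∣m d p))

coprime-*ʳ : ∀ {p k x} → Prime p → ¬ p ∣ k → Coprime k x → Coprime k (p * x)
coprime-*ʳ pr p∤k c (d∣k , d∣px) with prime-divisor-split pr d∣px
... | inj₁ p∣d = contradiction (∣-trans p∣d d∣k) p∤k
... | inj₂ d∣x = c (d∣k , d∣x)

coprime-*ˡ : ∀ {p j x} → Prime p → ¬ p ∣ x → Coprime j x → Coprime (p * j) x
coprime-*ˡ pr p∤x c (d∣pj , d∣x) with prime-divisor-split pr d∣pj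
... | inj₁ p∣d = contradiction (∣-trans p∣d d∣x) p∤x
... | inj₂ d∣j = c (d∣j , d∣x)

coprimeTo-by-p : ∀ {p} x k → Prime p →
                 coprimeTo x k ≡ coprimeTo (p * x) k + gate (does (p ∣? k)) (coprimeTo x k)
coprimeTo-by-p {p} x k pr with p ∣? k
... | yes p∣k = sym (cong (_+ coprimeTo x k) (gate-no (gcd k (p * x) ≟ 1) 1 λ g →
                  prime≢1 pr (gcd≡1⇒coprime g (p∣k , m∣m*n x))))
... | no p∤k  = trans (coprimeTo-⇔ {k = k} {l = k} (coprime-*ʳ pr p∤k)
                                   λ c (d∣k , d∣x) → c (d∣k , ∣n⇒∣m*n p d∣x))
                      (sym (+-identityʳ _))

φ-prime-multiple : ∀ q x → Prime (suc q) → ¬ suc q ∣ x → φ (suc q * x) ≡ q * φ x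
φ-prime-multiple q x pr p∤x = +-cancelʳ-≡ (φ x) _ _ (begin
  φ (p * x) + φ x
    ≡⟨ cong₂ _+_ (φ-as-sum (p * x)) (sym multiples-coprime-to-x) ⟩
  sumTo (coprimeTo (p * x)) (p * x) + sumTo onMultiples (p * x)
    ≡⟨ sym (sumTo-+ (coprimeTo (p * x)) onMultiples (p * x)) ⟩
  sumTo (λ k → coprimeTo (p * x) k + onMultiples k) (p * x)
    ≡⟨ sym (sumTo-cong (p * x) λ k _ _ → coprimeTo-by-p x k pr) ⟩
  sumTo (coprimeTo x) (p * x)
    ≡⟨ cong (sumTo (coprimeTo x)) (*-comm p x) ⟩
  sumTo (coprimeTo x) (x * p)
    ≡⟨ coprime-count-periodic x p ⟩
  p * φ x
    ≡⟨ +-comm (φ x) (q * φ x) ⟩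
  q * φ x + φ x
    ∎)
  where
  p : ℕ
  p = suc q
  onMultiples : ℕ → ℕ
  onMultiples k = gate (does (p ∣? k)) (coprimeTo x k)
  -- p·j is coprime to x exactly when j is
  multiples-coprime-to-x : sumTo onMultiples (p * x) ≡ φ x
  multiples-coprime-to-x = begin
    sumTo onMultiples (p * x)          ≡⟨ sumTo-multiples q (coprimeTo x) x ⟩
    sumTo (λ j → coprimeTo x (p * j)) x
      ≡⟨ sumTo-cong x (λ j _ _ → coprimeTo-⇔ {k = p * j} {l = j}
                                   (λ c (d∣j , d∣x) → c (∣n⇒∣m*n p d∣j , d∣x)) (coprime-*ˡ pr p∤x)) ⟩
    sumTo (coprimeTo x) x              ≡⟨ sym (φ-as-sum x) ⟩
    φ x                                ∎

divisorTerm : ℕ → (ℕ → Bool) → ℕ → ℕ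
divisorTerm N f k = gate (does (k ∣? N)) (gate (f k) (φ k))

selectedSum : ℕ → (ℕ → Bool) → ℕ
selectedSum N f = sumTo (divisorTerm N f) N

-- Every a ≤ N (0 included) is such a sum; this is φ-practicality up to representation.
φ-Complete : ℕ → Set
φ-Complete N = ∀ a → a ≤ N → Σ (ℕ → Bool) λ f → selectedSum N f ≡ a

φ-complete-1 : φ-Complete 1
φ-complete-1 zero           _ = (λ _ → false) , refl
φ-complete-1 (suc zero)     _ = (λ _ → true) , refl
φ-complete-1 (suc (suc _)) (s≤s ())

φ-complete⇒φ-practical : ∀ {n} → φ-Complete n → φ-practical n
φ-complete⇒φ-practical {n} complete m _ m≤n with complete m m≤n
... | f , sum≡m = filter keep? (divisors n) , filter-⊆ keep? (divisors n) , (begin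
  sum (map φ (filter keep? (divisors n)))
    ≡⟨ sum-filter keep? φ (divisors n) ⟩
  sum (map (λ k → gate (f k) (φ k)) (filter (_∣? n) (range1 n)))
    ≡⟨ sum-filter (_∣? n) _ (range1 n) ⟩
  sum (map (λ k → gate (does (k ∣? n)) (gate (f k) (φ k))) (range1 n))
    ≡⟨ sumTo-range1 _ n ⟩
  selectedSum n f
    ≡⟨ sum≡m ⟩
  m ∎)
  where
  keep? : Decidable (λ k → T (f k))
  keep? k = T? (f k)

divisorTerm-beyond : ∀ {N} f → 1 ≤ N → ∀ r → 1 ≤ r → divisorTerm N f (N + r) ≡ 0
divisorTerm-beyond {N} f 1≤N r 1≤r = gate-no ((N + r) ∣? N) _ λ N+r∣N →
  <⇒≱ (m<m+n N 1≤r) (∣⇒≤ ⦃ >-nonZero 1≤N ⦄ N+r∣N)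

merge : (p : ℕ) .{{_ : NonZero p}} → (ℕ → Bool) → (ℕ → Bool) → ℕ → Bool
merge p f₁ f₂ k = if does (p ∣? k) then f₂ (k / p) else f₁ k

merge-yes : ∀ {p} .{{_ : NonZero p}} {f₁ f₂ k} → p ∣ k → merge p f₁ f₂ k ≡ f₂ (k / p)
merge-yes {p} {k = k} p∣k rewrite dec-true (p ∣? k) p∣k = refl

merge-no : ∀ {p} .{{_ : NonZero p}} {f₁ f₂ k} → ¬ p ∣ k → merge p f₁ f₂ k ≡ f₁ k
merge-no {p} {k = k} p∤k rewrite dec-false (p ∣? k) p∤k = refl

-- For p = q + 1 prime with p ∤ m, the divisors of p·m are the k ∣ m and the p·j with j ∣ m.
module _ {q m} (pr : Prime (suc q)) (p∤m : ¬ suc q ∣ m) (f₁ f₂ : ℕ → Bool) where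
  private
    p : ℕ
    p = suc q
    term : ℕ → ℕ
    term = divisorTerm (p * m) (merge p f₁ f₂)

  -- a non-multiple k of p divides p·m iff it divides m; a multiple of p never divides m
  merge-term-split : ∀ k → term k ≡ gate (does (p ∣? k)) (term k) + divisorTerm m f₁ k
  merge-term-split k = split (p ∣? k)
    where
    split : Dec (p ∣ k) → term k ≡ gate (does (p ∣? k)) (term k) + divisorTerm m f₁ k
    split (yes p∣k) = trans (sym (+-identityʳ (term k))) (sym (cong₂ _+_
      (gate-yes (p ∣? k) (term k) p∣k) (gate-no (k ∣? m) _ λ k∣m → p∤m (∣-trans p∣k k∣m))))
    split (no p∤k) = begin
      term k
        ≡⟨ cong (λ b → gate (does (k ∣? p * m)) (gate b (φ k))) (merge-no {f₁ = f₁} {f₂} p∤k) ⟩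
      gate (does (k ∣? p * m)) (gate (f₁ k) (φ k))
        ≡⟨ gate-⇔ (k ∣? p * m) (k ∣? m) _ k∣pm⇒k∣m (∣n⇒∣m*n p) ⟩
      divisorTerm m f₁ k
        ≡⟨ cong (_+ divisorTerm m f₁ k) (sym (gate-no (p ∣? k) (term k) p∤k)) ⟩
      gate (does (p ∣? k)) (term k) + divisorTerm m f₁ k
        ∎
      where
      k∣pm⇒k∣m : k ∣ p * m → k ∣ m
      k∣pm⇒k∣m k∣pm = [ (λ p∣k → contradiction p∣k p∤k) , (λ k∣m → k∣m) ]′
                            (prime-divisor-split pr k∣pm)

  -- p·j divides p·m iff j ∣ m, it is selected iff f₂ selects j, and then φ(p·j) = q·φ(j)
  merge-term-multiple : ∀ j → term (p * j) ≡ q * divisorTerm m f₂ j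
  merge-term-multiple j = begin
    term (p * j)
      ≡⟨ cong (λ b → gate (does (p * j ∣? p * m)) (gate b (φ (p * j))))
              (trans (merge-yes {f₁ = f₁} {f₂} (m∣m*n j)) (cong f₂ pj/p≡j)) ⟩
    gate (does (p * j ∣? p * m)) (gate (f₂ j) (φ (p * j)))
      ≡⟨ gate-⇔ (p * j ∣? p * m) (j ∣? m) _ (*-cancelˡ-∣ p) (*-monoʳ-∣ p) ⟩
    gate (does (j ∣? m)) (gate (f₂ j) (φ (p * j)))
      ≡⟨ gate-cong (j ∣? m) (λ j∣m →
           cong (gate (f₂ j)) (φ-prime-multiple q j pr λ p∣j → p∤m (∣-trans p∣j j∣m))) ⟩
    gate (does (j ∣? m)) (gate (f₂ j) (q * φ j))
      ≡⟨ cong (gate (does (j ∣? m))) (gate-* (f₂ j) q (φ j)) ⟩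
    gate (does (j ∣? m)) (q * gate (f₂ j) (φ j))
      ≡⟨ gate-* (does (j ∣? m)) q _ ⟩
    q * divisorTerm m f₂ j
      ∎
    where
    pj/p≡j : p * j / p ≡ j
    pj/p≡j = trans (cong (_/ p) (*-comm p j)) (m*n/n≡m j p)

  selectedSum-merge : 1 ≤ m →
    selectedSum (p * m) (merge p f₁ f₂) ≡ selectedSum m f₁ + q * selectedSum m f₂
  selectedSum-merge 1≤m = begin
    sumTo term (p * m)
      ≡⟨ sumTo-cong (p * m) (λ k _ _ → merge-term-split k) ⟩
    sumTo (λ k → gate (does (p ∣? k)) (term k) + divisorTerm m f₁ k) (p * m)
      ≡⟨ sumTo-+ _ (divisorTerm m f₁) (p * m) ⟩
    sumTo (λ k → gate (does (p ∣? k)) (term k)) (p * m) + sumTo (divisorTerm m f₁) (m + q * m)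
      ≡⟨ cong₂ _+_ (sumTo-multiples q term m) (sumTo-split (divisorTerm m f₁) m (q * m)) ⟩
    sumTo (λ j → term (p * j)) m
      + (selectedSum m f₁ + sumTo (λ r → divisorTerm m f₁ (m + r)) (q * m))
      ≡⟨ cong₂ _+_ (sumTo-cong m (λ j _ _ → merge-term-multiple j))
                   (cong (selectedSum m f₁ +_) (sumTo-zero _ (q * m) λ r 1≤r _ →
                     divisorTerm-beyond f₁ 1≤m r 1≤r)) ⟩
    sumTo (λ j → q * divisorTerm m f₂ j) m + (selectedSum m f₁ + 0)
      ≡⟨ cong₂ _+_ (sumTo-* q (divisorTerm m f₂) m) (+-identityʳ _) ⟩
    q * selectedSum m f₂ + selectedSum m f₁
      ≡⟨ +-comm _ (selectedSum m f₁) ⟩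
    selectedSum m f₁ + q * selectedSum m f₂
      ∎

two-digit : ∀ q m c .{{_ : NonZero q}} → q ≤ suc m → c ≤ suc q * m →
            Σ ℕ λ a → Σ ℕ λ b → a ≤ m × b ≤ m × a + q * b ≡ c
two-digit q m c q≤m+1 c≤[q+1]m with c / q ≤? m
... | yes c/q≤m = c % q , c / q , ≤-pred (≤-trans (m%n<n c q) q≤m+1) , c/q≤m ,
                  sym (trans (m≡m%n+[m/n]*n c q) (cong (c % q +_) (*-comm (c / q) q)))
... | no c/q≰m  = c ∸ q * m , m , c∸qm≤m , ≤-refl , m∸n+n≡m qm≤c
  where
  qm≤c : q * m ≤ c
  qm≤c = ≤-trans (*-monoʳ-≤ q (<⇒≤ (≰⇒> c/q≰m)))
                 (subst (_≤ c) (*-comm (c / q) q) (m/n*n≤m c q))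
  c∸qm≤m : c ∸ q * m ≤ m
  c∸qm≤m = subst (c ∸ q * m ≤_) (m+n∸n≡m m (q * m)) (∸-monoˡ-≤ (q * m) c≤[q+1]m)

-- Adjoining a prime p ≤ m + 2 with p ∤ m preserves φ-completeness:
-- write c ≤ p·m as a + (p − 1)·b and merge selections for a and for b.
φ-complete-prime-multiple : ∀ {p m} → Prime p → ¬ p ∣ m → 1 ≤ m → p ≤ 2 + m →
                            φ-Complete m → φ-Complete (p * m)
φ-complete-prime-multiple {0} pr = contradiction pr ¬prime[0]
φ-complete-prime-multiple {1} pr = contradiction pr ¬prime[1]
φ-complete-prime-multiple {p@(suc q@(suc _))} {m} pr p∤m 1≤m p≤m+2 complete c c≤pm
  with two-digit q m c (≤-pred p≤m+2) c≤pm
... | a , b , a≤m , b≤m , a+qb≡c with complete a a≤m | complete b b≤m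
... | f₁ , sum₁≡a | f₂ , sum₂≡b = merge p f₁ f₂ , (begin
  selectedSum (p * m) (merge p f₁ f₂)         ≡⟨ selectedSum-merge pr p∤m f₁ f₂ 1≤m ⟩
  selectedSum m f₁ + q * selectedSum m f₂     ≡⟨ cong₂ (λ u v → u + q * v) sum₁≡a sum₂≡b ⟩
  a + q * b                                   ≡⟨ a+qb≡c ⟩
  c                                           ∎)

least-prime-factor : ∀ Q → .{{_ : NonTrivial Q}} → Σ ℕ λ p → Prime p × p ∣ Q × p Rough Q
least-prime-factor Q = search (Q ∸ 2) 0 (m∸n+n≡m (nonTrivial⇒n>1 Q)) 2-rough
  where
  -- trial division by 2 + i, 3 + i, …, Q; there are k + 1 candidates left
  search : ∀ k i → k + (2 + i) ≡ Q → (2 + i) Rough Q → Σ ℕ λ p → Prime p × p ∣ Q × p Rough Q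
  search k i k+2+i≡Q rough with 2 + i ∣? Q
  ... | yes d∣Q = 2 + i , rough∧∣⇒prime rough d∣Q , d∣Q , rough
  search zero    i 2+i≡Q       rough | no d∤Q = contradiction (subst (2 + i ∣_) 2+i≡Q ∣-refl) d∤Q
  search (suc k) i k+3+i≡Q     rough | no d∤Q =
    search k (suc i) (trans (+-suc k (2 + i)) k+3+i≡Q) (∤⇒rough-suc d∤Q rough)

rough⇒coprime : ∀ {p Q x} → p Rough Q → 1 ≤ x → x < p → Coprime x Q
rough⇒coprime rough 1≤x x<p {zero}       (0∣x , _)   = contradiction (0∣⇒≡0 0∣x) (≢-sym (<⇒≢ 1≤x))
rough⇒coprime rough 1≤x x<p {suc zero}   _           = refl
rough⇒coprime rough 1≤x x<p {2+ _}       (d∣x , d∣Q) =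
  contradiction (hasNonTrivialDivisor (≤-<-trans (∣⇒≤ ⦃ >-nonZero 1≤x ⦄ d∣x) x<p) d∣Q) rough

below-least-prime-divides : ∀ {p P Q x} → p Rough Q → x ∣ P * Q → 1 ≤ x → x < p → x ∣ P
below-least-prime-divides {P = P} {Q} {x} rough x∣PQ 1≤x x<p =
  coprime-divisor (rough⇒coprime rough 1≤x x<p) (subst (x ∣_) (*-comm P Q) x∣PQ)

proper-divisor-≤-half : ∀ {e P} → e ∣ P → e < P → 2 * e ≤ P
proper-divisor-≤-half {e} (divides zero P≡0) e<P = contradiction (subst (e <_) P≡0 e<P) n≮0
proper-divisor-≤-half {e} (divides (suc zero) P≡e) e<P =
  contradiction (subst (e <_) (trans P≡e (+-identityʳ e)) e<P) (n≮n e)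
proper-divisor-≤-half {e} (divides (2+ c) P≡[2+c]e) _ =
  subst (2 * e ≤_) (sym P≡[2+c]e) (*-monoˡ-≤ e {2} {2 + c} (s≤s (s≤s z≤n)))

-- What the proof uses of strict 2-density: n is positive, squarefree and even, and every
-- divisor D with 2 < D < n has a divisor e of n with D/2 < e < D.
record DivisorDense (n : ℕ) : Set where
  field
    positive   : 1 ≤ n
    squarefree : Squarefree n
    even       : 2 ∣ n
    gap        : ∀ {D} → D ∣ n → 2 < D → D < n → Σ ℕ λ e → e ∣ n × e < D × D < 2 * e

module _ {n} (dense : DivisorDense n) where
  open DivisorDense dense

  cofactor-positive : ∀ {P Q} → P * Q ≡ n → 1 ≤ P
  cofactor-positive {zero} 0≡n = contradiction (sym 0≡n) (≢-sym (<⇒≢ positive))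
  cofactor-positive {suc P} _  = s≤s z≤n

  -- If n = P·Q and p is the least prime factor of Q, then p ≤ P + 2.  Divisors of n below p
  -- divide P; so a gap divisor of n below P (if P > 2) or below p (if P = 2, forced by
  -- evenness when P ≤ 2) would be a proper divisor exceeding half of P, resp. force p < 4.
  least-prime-bound : ∀ {P Q p} → P * Q ≡ n → 1 < Q → Prime p → p ∣ Q → p Rough Q → p ≤ 2 + P
  least-prime-bound {P} {Q} {p} PQ≡n 1<Q pr p∣Q rough = ≮⇒≥ λ P+2<p → case 2 <? P of λ where
      (yes 2<P) → large-P 2<P (<-trans (m<n+m P z<s) P+2<p)
      (no 2≮P)  → small-P (≮⇒≥ 2≮P) P+2<p
    where
    1≤P : 1 ≤ P
    1≤P = cofactor-positive PQ≡n
    below-p-divides-P : ∀ {x} → x ∣ n → x < p → x ∣ P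
    below-p-divides-P {x} x∣n = below-least-prime-divides rough (subst (x ∣_) (sym PQ≡n) x∣n)
                                  (n≢0⇒n>0 λ { refl → <⇒≢ positive (sym (0∣⇒≡0 x∣n)) })
    -- P > 2: the gap divisor below P divides P and exceeds P/2
    large-P : 2 < P → P < p → ⊥
    large-P 2<P P<p with gap (subst (P ∣_) PQ≡n (m∣m*n Q)) 2<P
                             (subst (P <_) PQ≡n (m<m*n P Q ⦃ >-nonZero 1≤P ⦄ 1<Q))
    ... | e , e∣n , e<P , P<2e =
      <⇒≱ P<2e (proper-divisor-≤-half (below-p-divides-P e∣n (<-trans e<P P<p)) e<P)
    -- P ≤ 2: evenness forces P = 2, and the gap divisor below p divides 2, so p < 4
    small-P : P ≤ 2 → 2 + P < p → ⊥
    small-P P≤2 P+2<p = case gap (∣-trans p∣Q (subst (Q ∣_) PQ≡n (n∣m*n P))) 2<p p<n of λ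
      (e , e∣n , e<p , p<2e) →
        <⇒≱ (<-≤-trans p<2e (*-monoʳ-≤ 2 (∣⇒≤ (subst (e ∣_) P≡2 (below-p-divides-P e∣n e<p)))))
            (<⇒≤ (subst (λ P → 2 + P < p) P≡2 P+2<p))
      where
      2<p : 2 < p
      2<p = ≤-<-trans (m≤m+n 2 P) P+2<p
      P≡2 : P ≡ 2
      P≡2 = ≤-antisym P≤2 (∣⇒≤ ⦃ >-nonZero 1≤P ⦄ (below-p-divides-P even 2<p))
      Q<n : Q < n
      Q<n = subst (Q <_) (trans (*-comm Q P) PQ≡n)
                  (m<m*n Q P ⦃ >-nonZero (<-trans z<s 1<Q) ⦄ (≤-reflexive (sym P≡2)))
      p<n : p < n
      p<n = ≤-<-trans (∣⇒≤ ⦃ >-nonZero (<-trans z<s 1<Q) ⦄ p∣Q) Q<n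

  -- The least prime
  -- p of Q satisfies p ≤ P + 2 and p ∤ P (n is squarefree), so p·P is φ-complete and
  -- n = (p·P)·(Q / p) with a smaller cofactor.
  φ-complete-cofactor : ∀ Q {P} → P * Q ≡ n → φ-Complete P → φ-Complete n
  φ-complete-cofactor = <-rec Motive step
    where
    Motive : ℕ → Set
    Motive Q = ∀ {P} → P * Q ≡ n → φ-Complete P → φ-Complete n
    step : ∀ Q → (∀ {Q′} → Q′ < Q → Motive Q′) → Motive Q
    step zero       _ {P} P0≡n _        =
      contradiction (trans (sym P0≡n) (*-zeroʳ P)) (≢-sym (<⇒≢ positive))
    step (suc zero) _ {P} P1≡n complete =
      subst φ-Complete (trans (sym (*-identityʳ P)) P1≡n) complete
    step Q@(2+ _)  smaller {P} PQ≡n complete with least-prime-factor Q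
    ... | p , pr , p∣Q , rough = smaller (quotient-< p∣Q ⦃ prime⇒nonTrivial pr ⦄) pPQ′≡n
            (φ-complete-prime-multiple pr p∤P (cofactor-positive PQ≡n)
              (least-prime-bound PQ≡n (s≤s (s≤s z≤n)) pr p∣Q rough) complete)
      where
      pPQ′≡n : p * P * quotient p∣Q ≡ n
      pPQ′≡n = begin
        p * P * quotient p∣Q    ≡⟨ cong (_* quotient p∣Q) (*-comm p P) ⟩
        P * p * quotient p∣Q    ≡⟨ *-assoc P p (quotient p∣Q) ⟩
        P * (p * quotient p∣Q)  ≡⟨ cong (P *_) (sym (m∣n⇒n≡m*quotient p∣Q)) ⟩
        P * Q                   ≡⟨ PQ≡n ⟩
        n                       ∎
      p∤P : ¬ p ∣ P
      p∤P p∣P = prime≢1 pr (squarefree p (subst (p * p ∣_) PQ≡n (*-pres-∣ p∣P p∣Q)))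

divisorDense⇒φ-complete : ∀ {n} → DivisorDense n → φ-Complete n
divisorDense⇒φ-complete {n} dense = φ-complete-cofactor dense n (*-identityˡ n) φ-complete-1

range1-∈⁻ : ∀ {x} n → x ∈ range1 n → 1 ≤ x × x ≤ n
range1-∈⁻ (suc n) x∈ with ∈-++⁻ (range1 n) x∈
... | inj₁ x∈range1n    = let (1≤x , x≤n) = range1-∈⁻ n x∈range1n in 1≤x , m≤n⇒m≤1+n x≤n
... | inj₂ (here refl)  = s≤s z≤n , ≤-refl

range1-∈⁺ : ∀ {x} n → 1 ≤ x → x ≤ n → x ∈ range1 n
range1-∈⁺ zero    1≤x x≤0 = contradiction x≤0 (<⇒≱ 1≤x)
range1-∈⁺ (suc n) 1≤x x≤n+1 with m≤n⇒m<n∨m≡n x≤n+1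
... | inj₁ (s≤s x≤n) = ∈-++⁺ˡ (range1-∈⁺ n 1≤x x≤n)
... | inj₂ refl      = ∈-++⁺ʳ (range1 n) (here refl)

range1-sorted : ∀ n → AllPairs _<_ (range1 n)
range1-sorted zero    = []
range1-sorted (suc n) = AllPairs.++⁺ (range1-sorted n) ([] ∷ [])
  (All.tabulate λ x∈ → s≤s (proj₂ (range1-∈⁻ n x∈)) ∷ [])

divisors-sorted : ∀ n → AllPairs _<_ (divisors n)
divisors-sorted n = AllPairs.filter⁺ (_∣? n) (range1-sorted n)

∈-divisors⁻ : ∀ {x} n → x ∈ divisors n → x ∣ n × 1 ≤ x
∈-divisors⁻ n x∈ = let (x∈range , x∣n) = ∈-filter⁻ (_∣? n) x∈ in x∣n , proj₁ (range1-∈⁻ n x∈range)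

∈-divisors⁺ : ∀ {x} n → 1 ≤ n → x ∣ n → x ∈ divisors n
∈-divisors⁺ {x} n 1≤n x∣n = ∈-filter⁺ (_∣? n) (range1-∈⁺ n 1≤x (∣⇒≤ ⦃ >-nonZero 1≤n ⦄ x∣n)) x∣n
  where
  1≤x : 1 ≤ x
  1≤x = n≢0⇒n>0 λ { refl → <⇒≢ 1≤n (sym (0∣⇒≡0 x∣n)) }

lookup-< : ∀ {xs} → AllPairs _<_ xs → (i j : Fin (length xs)) →
           toℕ i < toℕ j → lookup xs i < lookup xs j
lookup-< (x<xs ∷ _)   zero    (suc j) _         = All.lookup x<xs (∈-lookup j)
lookup-< (_ ∷ sorted) (suc i) (suc j) (s≤s i<j) = lookup-< sorted i j i<j

lookup-≤ : ∀ {xs} → AllPairs _<_ xs → (i j : Fin (length xs)) →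
           toℕ i ≤ toℕ j → lookup xs i ≤ lookup xs j
lookup-≤ {xs} sorted i j i≤j with m≤n⇒m<n∨m≡n i≤j
... | inj₁ i<j = <⇒≤ (lookup-< sorted i j i<j)
... | inj₂ i≡j = ≤-reflexive (cong (lookup xs) (toℕ-injective i≡j))

d-∣ : ∀ n i → d n i ∣ n
d-∣ n i = proj₁ (∈-divisors⁻ n (∈-lookup i))

d-positive : ∀ n i → 1 ≤ d n i
d-positive n i = proj₂ (∈-divisors⁻ n (∈-lookup i))

position : ∀ {n x} → 1 ≤ n → x ∣ n → Σ (Fin (τ n)) λ i → d n i ≡ x
position {n} 1≤n x∣n = index x∈ , sym (lookup-index x∈)
  where
  x∈ : _ ∈ divisors n
  x∈ = ∈-divisors⁺ n 1≤n x∣n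

d-first : ∀ {n} → 1 ≤ n → ∀ i → toℕ i ≡ 0 → d n i ≡ 1
d-first {n} 1≤n i i≡0 with position 1≤n (1∣ n)
... | k , dk≡1 =
  ≤-antisym (subst (d n i ≤_) dk≡1 (lookup-≤ (divisors-sorted n) i k i≤k)) (d-positive n i)
  where
  i≤k : toℕ i ≤ toℕ k
  i≤k = subst (_≤ toℕ k) (sym i≡0) z≤n

d-last : ∀ {n} → 1 ≤ n → ∀ j → suc (toℕ j) ≡ τ n → n ≤ d n j
d-last {n} 1≤n j j+1≡τ with position 1≤n (∣-refl {n})
... | k , dk≡n = subst (_≤ d n j) dk≡n (lookup-≤ (divisors-sorted n) k j k≤j)
  where
  k≤j : toℕ k ≤ toℕ j
  k≤j = ≤-pred (subst (toℕ k <_) (sym j+1≡τ) (toℕ<n k))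

τ-positive⇒positive : ∀ n → 0 < τ n → 1 ≤ n
τ-positive⇒positive (suc n) _ = s≤s z≤n

module _ {n} (sd : Strictly2Dense n) where
  private
    t : ℕ
    t = proj₁ (proj₂ sd)
    τ≡t+2 : τ n ≡ 2 + t
    τ≡t+2 = proj₁ (proj₂ (proj₂ sd))
    steps : ∀ (i j : Fin (τ n)) → toℕ j ≡ suc (toℕ i) →
            (toℕ i ≡ 0 → d n j ≡ 2 * d n i) × (toℕ j ≡ suc t → d n j ≡ 2 * d n i) ×
            (1 ≤ toℕ i → toℕ j < suc t → d n j < 2 * d n i)
    steps = proj₂ (proj₂ (proj₂ sd))

  dense-positive : 1 ≤ n
  dense-positive = τ-positive⇒positive n (subst (0 <_) (sym τ≡t+2) z<s)

  -- d₁ = 2·d₀ = 2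
  dense-even : 2 ∣ n
  dense-even = subst (_∣ n) d₁≡2 (d-∣ n i₁)
    where
    0<τ : 0 < τ n
    0<τ = subst (0 <_) (sym τ≡t+2) z<s
    1<τ : 1 < τ n
    1<τ = subst (1 <_) (sym τ≡t+2) (s≤s z<s)
    i₀ i₁ : Fin (τ n)
    i₀ = fromℕ< 0<τ
    i₁ = fromℕ< 1<τ
    i₁≡i₀+1 : toℕ i₁ ≡ suc (toℕ i₀)
    i₁≡i₀+1 = trans (toℕ-fromℕ< 1<τ) (cong suc (sym (toℕ-fromℕ< 0<τ)))
    d₁≡2 : d n i₁ ≡ 2
    d₁≡2 = trans (proj₁ (steps i₀ i₁ i₁≡i₀+1) (toℕ-fromℕ< 0<τ))
                 (cong (2 *_) (d-first dense-positive i₀ (toℕ-fromℕ< 0<τ)))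

  -- A divisor D = d n j with 2 < D < n is neither d₀ = 1, d₁ = 2 nor the last divisor n,
  -- so its predecessor e = d n (j − 1) satisfies e < D < 2·e.
  dense-gap : ∀ {D} → D ∣ n → 2 < D → D < n → Σ ℕ λ e → e ∣ n × e < D × D < 2 * e
  dense-gap {D} D∣n 2<D D<n with position dense-positive D∣n
  ... | j , dj≡D = predecessor (toℕ j) refl
    where
    consecutive : ∀ i → toℕ j ≡ suc (toℕ i) → Σ ℕ λ e → e ∣ n × e < D × D < 2 * e
    consecutive i j≡i+1 with toℕ i ≟ 0 | toℕ j ≟ suc t
    ... | yes i≡0 | _         = contradiction D≡2 (≢-sym (<⇒≢ 2<D))
      where
      D≡2 : D ≡ 2
      D≡2 = trans (sym dj≡D) (trans (proj₁ (steps i j j≡i+1) i≡0)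
                                    (cong (2 *_) (d-first dense-positive i i≡0)))
    ... | no _    | yes j≡t+1 = contradiction (subst (n ≤_) dj≡D n≤dj) (<⇒≱ D<n)
      where
      n≤dj : n ≤ d n j
      n≤dj = d-last dense-positive j (trans (cong suc j≡t+1) (sym τ≡t+2))
    ... | no i≢0  | no j≢t+1  =
      d n i , d-∣ n i , subst (d n i <_) dj≡D di<dj , subst (_< 2 * d n i) dj≡D dj<2di
      where
      di<dj : d n i < d n j
      di<dj = lookup-< (divisors-sorted n) i j (subst (toℕ i <_) (sym j≡i+1) (n<1+n (toℕ i)))
      dj<2di : d n j < 2 * d n i
      dj<2di = proj₂ (proj₂ (steps i j j≡i+1)) (n≢0⇒n>0 i≢0)
                 (≤∧≢⇒< (≤-pred (subst (toℕ j <_) τ≡t+2 (toℕ<n j))) j≢t+1)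
    predecessor : ∀ k → toℕ j ≡ k → Σ ℕ λ e → e ∣ n × e < D × D < 2 * e
    predecessor zero    j≡0   = contradiction (trans (sym dj≡D) (d-first dense-positive j j≡0))
                                              (≢-sym (<⇒≢ (<-trans (n<1+n 1) 2<D)))
    predecessor (suc k) j≡k+1 =
      consecutive (fromℕ< k<τ) (trans j≡k+1 (cong suc (sym (toℕ-fromℕ< k<τ))))
      where
      k<τ : k < τ n
      k<τ = <-trans (n<1+n k) (subst (_< τ n) j≡k+1 (toℕ<n j))

  strictly2Dense⇒divisorDense : DivisorDense n
  strictly2Dense⇒divisorDense = record
    { positive   = dense-positive
    ; squarefree = proj₁ sd
    ; even       = dense-even
    ; gap        = dense-gap
    }

lemma5p4 : ∀ n → Strictly2Dense n → φ-practical n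
lemma5p4 n sd = φ-complete⇒φ-practical (divisorDense⇒φ-complete (strictly2Dense⇒divisorDense sd))
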